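{- Let $v>k>i\ge 0$ be integers with $v\ge 2k$ and $(v,k,i)\neq(2k,k,0)$, and let $X=J(v,k,i)$. Then the girth of $X$ is $$g(X)= \begin{cases} 3 & \text{if } v\geq 3(k-i); \\ 4 & \text{if } v<3(k-i) \text{ and } (v,k,i)\neq (2k+1,k,0); \\ 5 & \text{if } (v,k,i)=(5,2,0); \\ 6 & \text{if } (v,k,i)=(2k+1,k,0) \text{ and } k>2. \end{cases}$$
   Context: For integers $v>k>i\ge 0$, the generalized Johnson graph $J(v,k,i)$ is the simple undirected graph whose vertices are the $k$-element subsets of a fixed $v$-element set, two vertices $A,B$ being adjacent iff $|A\cap B|=i$. The girth is the length of a shortest cycle. -}

module Defs where

open import Data.Nat using (ℕ; zero; suc; _≤_; _<_)
open import Data.Empty using (⊥)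
open import Data.Fin using (Fin; zero; suc; inject₁; fromℕ)
open import Data.Fin.Subset using (Subset; _∩_; ∣_∣)
open import Data.Product using (Σ; _×_)
open import Relation.Binary.PropositionalEquality using (_≡_; _≢_)
open import Relation.Nullary using (¬_)
open import Function.Definitions using (Injective)

JAdj : (v i : ℕ) → Subset v → Subset v → Set
JAdj v i A B = ∣ A ∩ B ∣ ≡ i

record Cycle (v k i m : ℕ) : Set where
  field
    vert     : Fin (suc m) → Subset v
    vertSize : ∀ j → ∣ vert j ∣ ≡ k
    distinct : Injective _≡_ _≡_ vert
    step     : (j : Fin m) → JAdj v i (vert (inject₁ j)) (vert (suc j))
    close    : JAdj v i (vert (fromℕ m)) (vert zero)

HasCycle : (v k i n : ℕ) → Set
HasCycle v k i zero    = ⊥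
HasCycle v k i (suc m) = (3 ≤ suc m) × Cycle v k i m

GirthIs : (v k i g : ℕ) → Set
GirthIs v k i g = HasCycle v k i g × (∀ n → n < g → ¬ HasCycle v k i n)

module Submission where

-- The lower bounds are counting arguments. Inclusion–exclusion gives
-- |A| + |B| + |C| ≤ v + |A∩B| + |B∩C| + |A∩C| for subsets of a v-set, which bounds closed walks
-- of length 3 and, applied to the paths A-B-C and D-E-A, of length 5; in a 4-cycle the unions
-- A∪C and B∪D of opposite vertices have more than k points each (opposite vertices are distinct)
-- and meet in at most 4i points. In J(2k+1,k,0) this excludes triangles, squares and, for k > 2,
-- pentagons.
-- The cycles are assembled from a few small configurations, checked by evaluation, by two
-- operations on closed walks of equal length: juxtaposition on disjoint ground sets, which adds
-- v, k and i, and blowing up every point into x points, which multiplies them by x. Constant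
-- walks on the full and on the empty set contribute points common to all vertices and unused
-- points.

open import Defs
open import Data.Bool using (_≟_)
open import Data.Empty using (⊥-elim)
open import Data.Fin using (Fin; zero; suc; inject₁; fromℕ; #_)
import Data.Fin.Properties as Fin
open import Data.Fin.Subset using (Subset; _∩_; _∪_; ∣_∣; _⊆_; ⊤; ⊥; ⁅_⁆; inside; outside)
open import Data.Fin.Subset.Properties
  using ( p⊆q⇒∣p∣≤∣q∣; drop-∷-⊆; ∣p∣≤n; ∣⊤∣≡n; ∣⊥∣≡0; p∩q⊆p; p∩q⊆q; ∣p∩q∣≤∣p∣; x∈p∩q⁺
        ; ∩-idem; ∩-comm; ∩-distribˡ-∪; ∩-distribʳ-∪)
open import Data.Nat using (ℕ; zero; suc; _+_; _*_; _∸_; _≤_; _<_; z≤n; s≤s)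
open import Data.Nat.Properties hiding (_≟_)
import Data.Nat.Properties as ℕ
open import Data.Nat.Tactic.RingSolver using (solve-∀)
open import Algebra.Properties.CommutativeSemigroup +-commutativeSemigroup using (xy∙z≈xz∙y; xy∙z≈zy∙x)
open import Data.Product using (_×_; _,_)
open import Data.Sum using (inj₁; inj₂)
open import Data.Vec using (Vec; []; _∷_; _++_; replicate; lookup; here)
open import Data.Vec.Properties using (zipWith-++; zipWith-replicate; ++-injectiveˡ; ≡-dec)
open import Function.Definitions using (Injective)
open import Relation.Binary.PropositionalEquality
open import Relation.Nullary using (Dec; ¬_)
open import Relation.Nullary.Decidable using (True; toWitness; _→-dec_)

private variable n v v′ k k′ i i′ m : ℕ

∣p∩q∣≡∣q∩p∣ : (p q : Subset n) → ∣ p ∩ q ∣ ≡ ∣ q ∩ p ∣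
∣p∩q∣≡∣q∩p∣ p q = cong ∣_∣ (∩-comm p q)

∣p∪q∣+∣p∩q∣≡∣p∣+∣q∣ : (p q : Subset n) → ∣ p ∪ q ∣ + ∣ p ∩ q ∣ ≡ ∣ p ∣ + ∣ q ∣
∣p∪q∣+∣p∩q∣≡∣p∣+∣q∣ []            []            = refl
∣p∪q∣+∣p∩q∣≡∣p∣+∣q∣ (inside  ∷ p) (inside  ∷ q) = cong suc (begin
  ∣ p ∪ q ∣ + suc ∣ p ∩ q ∣    ≡⟨ +-suc _ _ ⟩
  suc (∣ p ∪ q ∣ + ∣ p ∩ q ∣)  ≡⟨ cong suc (∣p∪q∣+∣p∩q∣≡∣p∣+∣q∣ p q) ⟩
  suc (∣ p ∣ + ∣ q ∣)          ≡⟨ +-suc _ _ ⟨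
  ∣ p ∣ + suc ∣ q ∣            ∎)
  where open ≡-Reasoning
∣p∪q∣+∣p∩q∣≡∣p∣+∣q∣ (inside  ∷ p) (outside ∷ q) = cong suc (∣p∪q∣+∣p∩q∣≡∣p∣+∣q∣ p q)
∣p∪q∣+∣p∩q∣≡∣p∣+∣q∣ (outside ∷ p) (inside  ∷ q) =
  trans (cong suc (∣p∪q∣+∣p∩q∣≡∣p∣+∣q∣ p q)) (sym (+-suc _ _))
∣p∪q∣+∣p∩q∣≡∣p∣+∣q∣ (outside ∷ p) (outside ∷ q) = ∣p∪q∣+∣p∩q∣≡∣p∣+∣q∣ p q

∣p∪q∣≤∣p∣+∣q∣ : (p q : Subset n) → ∣ p ∪ q ∣ ≤ ∣ p ∣ + ∣ q ∣
∣p∪q∣≤∣p∣+∣q∣ p q = ≤-trans (m≤m+n _ _) (≤-reflexive (∣p∪q∣+∣p∩q∣≡∣p∣+∣q∣ p q))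

∣p∣+∣q∣≤n+∣p∩q∣ : (p q : Subset n) → ∣ p ∣ + ∣ q ∣ ≤ n + ∣ p ∩ q ∣
∣p∣+∣q∣≤n+∣p∩q∣ p q = begin
  ∣ p ∣ + ∣ q ∣          ≡⟨ ∣p∪q∣+∣p∩q∣≡∣p∣+∣q∣ p q ⟨
  ∣ p ∪ q ∣ + ∣ p ∩ q ∣  ≤⟨ +-monoˡ-≤ _ (∣p∣≤n (p ∪ q)) ⟩
  _ + ∣ p ∩ q ∣          ∎
  where open ≤-Reasoning

∣p∩[q∪r]∣≤∣p∩q∣+∣p∩r∣ : (p q r : Subset n) → ∣ p ∩ (q ∪ r) ∣ ≤ ∣ p ∩ q ∣ + ∣ p ∩ r ∣
∣p∩[q∪r]∣≤∣p∩q∣+∣p∩r∣ p q r rewrite ∩-distribˡ-∪ p q r = ∣p∪q∣≤∣p∣+∣q∣ (p ∩ q) (p ∩ r)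

∣[p∪q]∩r∣≤∣p∩r∣+∣q∩r∣ : (p q r : Subset n) → ∣ (p ∪ q) ∩ r ∣ ≤ ∣ p ∩ r ∣ + ∣ q ∩ r ∣
∣[p∪q]∩r∣≤∣p∩r∣+∣q∩r∣ p q r rewrite ∩-distribʳ-∪ r p q = ∣p∪q∣≤∣p∣+∣q∣ (p ∩ r) (q ∩ r)

∣p∣+∣q∣+∣r∣≤n+∣p∩q∣+∣q∩r∣+∣p∩r∣ : (p q r : Subset n) →
  ∣ p ∣ + ∣ q ∣ + ∣ r ∣ ≤ n + (∣ p ∩ q ∣ + ∣ q ∩ r ∣ + ∣ p ∩ r ∣)
∣p∣+∣q∣+∣r∣≤n+∣p∩q∣+∣q∩r∣+∣p∩r∣ {n} p q r = begin
  ∣ p ∣ + ∣ q ∣ + ∣ r ∣                    ≡⟨ cong (_+ ∣ r ∣) (∣p∪q∣+∣p∩q∣≡∣p∣+∣q∣ p q) ⟨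
  ∣ p ∪ q ∣ + ∣ p ∩ q ∣ + ∣ r ∣            ≡⟨ xy∙z≈xz∙y (∣ p ∪ q ∣) (∣ p ∩ q ∣) (∣ r ∣) ⟩
  ∣ p ∪ q ∣ + ∣ r ∣ + ∣ p ∩ q ∣            ≤⟨ +-monoˡ-≤ _ (∣p∣+∣q∣≤n+∣p∩q∣ (p ∪ q) r) ⟩
  n + ∣ (p ∪ q) ∩ r ∣ + ∣ p ∩ q ∣          ≤⟨ +-monoˡ-≤ _ (+-monoʳ-≤ n (∣[p∪q]∩r∣≤∣p∩r∣+∣q∩r∣ p q r)) ⟩
  n + (∣ p ∩ r ∣ + ∣ q ∩ r ∣) + ∣ p ∩ q ∣  ≡⟨ +-assoc n _ _ ⟩
  n + (∣ p ∩ r ∣ + ∣ q ∩ r ∣ + ∣ p ∩ q ∣)  ≡⟨ cong (n +_) (xy∙z≈zy∙x (∣ p ∩ r ∣) (∣ q ∩ r ∣) (∣ p ∩ q ∣)) ⟩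
  n + (∣ p ∩ q ∣ + ∣ q ∩ r ∣ + ∣ p ∩ r ∣)  ∎
  where open ≤-Reasoning

∣p∩q∣+∣p∩r∣≤∣p∣+∣q∩r∣ : (p q r : Subset n) → ∣ p ∩ q ∣ + ∣ p ∩ r ∣ ≤ ∣ p ∣ + ∣ q ∩ r ∣
∣p∩q∣+∣p∩r∣≤∣p∣+∣q∩r∣ p q r = begin
  ∣ p ∩ q ∣ + ∣ p ∩ r ∣                              ≡⟨ ∣p∪q∣+∣p∩q∣≡∣p∣+∣q∣ (p ∩ q) (p ∩ r) ⟨
  ∣ (p ∩ q) ∪ (p ∩ r) ∣ + ∣ (p ∩ q) ∩ (p ∩ r) ∣      ≡⟨ cong (λ s → ∣ s ∣ + ∣ (p ∩ q) ∩ (p ∩ r) ∣) (∩-distribˡ-∪ p q r) ⟨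
  ∣ p ∩ (q ∪ r) ∣ + ∣ (p ∩ q) ∩ (p ∩ r) ∣            ≤⟨ +-mono-≤ (∣p∩q∣≤∣p∣ p (q ∪ r)) (p⊆q⇒∣p∣≤∣q∣ inner) ⟩
  ∣ p ∣ + ∣ q ∩ r ∣                                  ∎
  where
  open ≤-Reasoning
  inner : (p ∩ q) ∩ (p ∩ r) ⊆ q ∩ r
  inner x∈ = x∈p∩q⁺ (p∩q⊆q p q (p∩q⊆p _ _ x∈) , p∩q⊆q p r (p∩q⊆q _ _ x∈))

p⊆q∧∣q∣≤∣p∣⇒p≡q : {p q : Subset n} → p ⊆ q → ∣ q ∣ ≤ ∣ p ∣ → p ≡ q
p⊆q∧∣q∣≤∣p∣⇒p≡q {p = []}          {[]}          _   _   = refl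
p⊆q∧∣q∣≤∣p∣⇒p≡q {p = outside ∷ p} {outside ∷ q} p⊆q q≤p =
  cong (outside ∷_) (p⊆q∧∣q∣≤∣p∣⇒p≡q (drop-∷-⊆ p⊆q) q≤p)
p⊆q∧∣q∣≤∣p∣⇒p≡q {p = outside ∷ p} {inside  ∷ q} p⊆q q≤p =
  ⊥-elim (<⇒≱ q≤p (p⊆q⇒∣p∣≤∣q∣ (drop-∷-⊆ p⊆q)))
p⊆q∧∣q∣≤∣p∣⇒p≡q {p = inside  ∷ p} {outside ∷ q} p⊆q q≤p with p⊆q here
... | ()
p⊆q∧∣q∣≤∣p∣⇒p≡q {p = inside  ∷ p} {inside  ∷ q} p⊆q (s≤s q≤p) =
  cong (inside ∷_) (p⊆q∧∣q∣≤∣p∣⇒p≡q (drop-∷-⊆ p⊆q) q≤p)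

∣p∩q∣<∣p∣ : {p q : Subset n} → ∣ p ∣ ≡ ∣ q ∣ → p ≢ q → ∣ p ∩ q ∣ < ∣ p ∣
∣p∩q∣<∣p∣ {p = p} {q} ∣p∣≡∣q∣ p≢q = ≤∧≢⇒< (∣p∩q∣≤∣p∣ p q) λ ∣p∩q∣≡∣p∣ → p≢q (begin
  p      ≡⟨ p⊆q∧∣q∣≤∣p∣⇒p≡q (p∩q⊆p p q) (≤-reflexive (sym ∣p∩q∣≡∣p∣)) ⟨
  p ∩ q  ≡⟨ p⊆q∧∣q∣≤∣p∣⇒p≡q (p∩q⊆q p q) (≤-reflexive (trans (sym ∣p∣≡∣q∣) (sym ∣p∩q∣≡∣p∣))) ⟩
  q      ∎)
  where open ≡-Reasoning

∣p∣<∣p∪q∣ : {p q : Subset n} → ∣ p ∣ ≡ ∣ q ∣ → p ≢ q → ∣ p ∣ < ∣ p ∪ q ∣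
∣p∣<∣p∪q∣ {p = p} {q} ∣p∣≡∣q∣ p≢q = +-cancelʳ-< (∣ p ∩ q ∣) _ _ (begin-strict
  ∣ p ∣ + ∣ p ∩ q ∣       <⟨ +-monoʳ-< (∣ p ∣) (∣p∩q∣<∣p∣ ∣p∣≡∣q∣ p≢q) ⟩
  ∣ p ∣ + ∣ p ∣           ≡⟨ cong (∣ p ∣ +_) ∣p∣≡∣q∣ ⟩
  ∣ p ∣ + ∣ q ∣           ≡⟨ ∣p∪q∣+∣p∩q∣≡∣p∣+∣q∣ p q ⟨
  ∣ p ∪ q ∣ + ∣ p ∩ q ∣   ∎)
  where open ≤-Reasoning

record ClosedWalk (v k i m : ℕ) : Set where
  field
    vert     : Fin (suc m) → Subset v
    vertSize : ∀ j → ∣ vert j ∣ ≡ k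
    step     : (j : Fin m) → JAdj v i (vert (inject₁ j)) (vert (suc j))
    close    : JAdj v i (vert (fromℕ m)) (vert zero)
open ClosedWalk

underlyingWalk : Cycle v k i m → ClosedWalk v k i m
underlyingWalk c = record
  { vert = Cycle.vert c ; vertSize = Cycle.vertSize c ; step = Cycle.step c ; close = Cycle.close c }

toCycle : (W : ClosedWalk v k i m) → Injective _≡_ _≡_ (vert W) → Cycle v k i m
toCycle W inj = record
  { vert = vert W ; vertSize = vertSize W ; distinct = inj ; step = step W ; close = close W }

closedWalk₃⇒cycle : i < k → ClosedWalk v k i 2 → Cycle v k i 2
closedWalk₃⇒cycle {i = i} {k = k} i<k W = toCycle W injective
  where
  loopless : ∀ a b → ∣ vert W a ∩ vert W b ∣ ≡ i → vert W a ≢ vert W b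
  loopless a b adj eq = <⇒≢ i<k (begin
    i                       ≡⟨ adj ⟨
    ∣ vert W a ∩ vert W b ∣ ≡⟨ cong (λ p → ∣ vert W a ∩ p ∣) eq ⟨
    ∣ vert W a ∩ vert W a ∣ ≡⟨ cong ∣_∣ (∩-idem (vert W a)) ⟩
    ∣ vert W a ∣            ≡⟨ vertSize W a ⟩
    k                       ∎)
    where open ≡-Reasoning
  injective : Injective _≡_ _≡_ (vert W)
  injective {zero}             {zero}             _  = refl
  injective {zero}             {suc zero}         eq = ⊥-elim (loopless _ _ (step W zero) eq)
  injective {zero}             {suc (suc zero)}   eq = ⊥-elim (loopless _ _ (close W) (sym eq))
  injective {suc zero}         {zero}             eq = ⊥-elim (loopless _ _ (step W zero) (sym eq))
  injective {suc zero}         {suc zero}         _  = refl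
  injective {suc zero}         {suc (suc zero)}   eq = ⊥-elim (loopless _ _ (step W (suc zero)) eq)
  injective {suc (suc zero)}   {zero}             eq = ⊥-elim (loopless _ _ (close W) eq)
  injective {suc (suc zero)}   {suc zero}         eq = ⊥-elim (loopless _ _ (step W (suc zero)) (sym eq))
  injective {suc (suc zero)}   {suc (suc zero)}   _  = refl

triangle-bound : ClosedWalk v k i 2 → 3 * k ≤ 3 * i + v
triangle-bound {v} {k} {i} W = begin
  3 * k                                    ≡⟨ triple k ⟩
  k + k + k                                ≡⟨ cong₂ _+_ (cong₂ _+_ (vertSize W (# 0)) (vertSize W (# 1)))
                                                          (vertSize W (# 2)) ⟨
  ∣ A ∣ + ∣ B ∣ + ∣ C ∣                     ≤⟨ ∣p∣+∣q∣+∣r∣≤n+∣p∩q∣+∣q∩r∣+∣p∩r∣ A B C ⟩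
  v + (∣ A ∩ B ∣ + ∣ B ∩ C ∣ + ∣ A ∩ C ∣)   ≡⟨ cong (v +_) (cong₂ _+_ (cong₂ _+_ (step W (# 0)) (step W (# 1)))
                                                                  (trans (∣p∩q∣≡∣q∩p∣ A C) (close W))) ⟩
  v + (i + i + i)                          ≡⟨ trans (cong (_+ v) (triple i)) (+-comm _ v) ⟨
  3 * i + v                                ∎
  where
  open ≤-Reasoning
  A = vert W (# 0)
  B = vert W (# 1)
  C = vert W (# 2)
  triple : ∀ x → 3 * x ≡ x + x + x
  triple = solve-∀

square-bound : Cycle v k i 3 → 2 * k + 2 ≤ 4 * i + v
square-bound {v} {k} {i} c = begin
  2 * k + 2                                        ≡⟨ double+2 k ⟩
  suc k + suc k                                    ≤⟨ +-mono-≤ (opposite (# 0) (# 2) λ ())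
                                                               (opposite (# 1) (# 3) λ ()) ⟩
  ∣ A ∪ C ∣ + ∣ B ∪ D ∣                             ≤⟨ ∣p∣+∣q∣≤n+∣p∩q∣ (A ∪ C) (B ∪ D) ⟩
  v + ∣ (A ∪ C) ∩ (B ∪ D) ∣                        ≤⟨ +-monoʳ-≤ v (∣[p∪q]∩r∣≤∣p∩r∣+∣q∩r∣ A C (B ∪ D)) ⟩
  v + (∣ A ∩ (B ∪ D) ∣ + ∣ C ∩ (B ∪ D) ∣)           ≤⟨ +-monoʳ-≤ v (+-mono-≤ (∣p∩[q∪r]∣≤∣p∩q∣+∣p∩r∣ A B D)
                                                                           (∣p∩[q∪r]∣≤∣p∩q∣+∣p∩r∣ C B D)) ⟩
  v + (∣ A ∩ B ∣ + ∣ A ∩ D ∣ + (∣ C ∩ B ∣ + ∣ C ∩ D ∣)) ≡⟨ cong (v +_) adjacencies ⟩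
  v + (i + i + (i + i))                            ≡⟨ quadruple i v ⟩
  4 * i + v                                        ∎
  where
  open ≤-Reasoning
  W = underlyingWalk c
  A = vert W (# 0)
  B = vert W (# 1)
  C = vert W (# 2)
  D = vert W (# 3)
  opposite : ∀ a b → a ≢ b → k < ∣ vert W a ∪ vert W b ∣
  opposite a b a≢b = subst (_< ∣ vert W a ∪ vert W b ∣) (vertSize W a)
    (∣p∣<∣p∪q∣ (trans (vertSize W a) (sym (vertSize W b))) (λ eq → a≢b (Cycle.distinct c eq)))
  adjacencies : ∣ A ∩ B ∣ + ∣ A ∩ D ∣ + (∣ C ∩ B ∣ + ∣ C ∩ D ∣) ≡ i + i + (i + i)
  adjacencies = cong₂ _+_
    (cong₂ _+_ (step W (# 0)) (trans (∣p∩q∣≡∣q∩p∣ A D) (close W)))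
    (cong₂ _+_ (trans (∣p∩q∣≡∣q∩p∣ C B) (step W (# 1))) (step W (# 2)))
  double+2 : ∀ x → 2 * x + 2 ≡ suc x + suc x
  double+2 = solve-∀
  quadruple : ∀ x y → y + (x + x + (x + x)) ≡ 4 * x + y
  quadruple = solve-∀

pentagon-bound : ClosedWalk v k i 4 → 5 * k ≤ 5 * i + 2 * v
pentagon-bound {v} {k} {i} W = arithmetic
  (twoSteps (# 0) (# 1) (# 2) (step W (# 0)) (step W (# 1)))
  (twoSteps (# 3) (# 4) (# 0) (step W (# 3)) (close W))
  (begin
    ∣ A ∩ C ∣ + ∣ D ∩ A ∣   ≡⟨ cong (∣ A ∩ C ∣ +_) (∣p∩q∣≡∣q∩p∣ D A) ⟩
    ∣ A ∩ C ∣ + ∣ A ∩ D ∣   ≤⟨ ∣p∩q∣+∣p∩r∣≤∣p∣+∣q∩r∣ A C D ⟩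
    ∣ A ∣ + ∣ C ∩ D ∣       ≡⟨ cong₂ _+_ (vertSize W (# 0)) (step W (# 2)) ⟩
    k + i                  ∎)
  where
  open ≤-Reasoning
  A = vert W (# 0)
  C = vert W (# 2)
  D = vert W (# 3)
  twoSteps : ∀ a b c → ∣ vert W a ∩ vert W b ∣ ≡ i → ∣ vert W b ∩ vert W c ∣ ≡ i →
             k + k + k ≤ v + (i + i + ∣ vert W a ∩ vert W c ∣)
  twoSteps a b c ab bc = begin
    k + k + k                       ≡⟨ cong₂ _+_ (cong₂ _+_ (vertSize W a) (vertSize W b)) (vertSize W c) ⟨
    ∣ vert W a ∣ + ∣ vert W b ∣ + ∣ vert W c ∣
                                    ≤⟨ ∣p∣+∣q∣+∣r∣≤n+∣p∩q∣+∣q∩r∣+∣p∩r∣ (vert W a) (vert W b) (vert W c) ⟩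
    v + (∣ vert W a ∩ vert W b ∣ + ∣ vert W b ∩ vert W c ∣ + ∣ vert W a ∩ vert W c ∣)
                                    ≡⟨ cong (λ s → v + (s + ∣ vert W a ∩ vert W c ∣)) (cong₂ _+_ ab bc) ⟩
    v + (i + i + ∣ vert W a ∩ vert W c ∣) ∎
  arithmetic : ∀ {x y} → k + k + k ≤ v + (i + i + x) → k + k + k ≤ v + (i + i + y) → x + y ≤ k + i →
               5 * k ≤ 5 * i + 2 * v
  arithmetic {x} {y} h₁ h₂ h₃ = +-cancelʳ-≤ k _ _ (begin
    5 * k + k                             ≡⟨ e₁ k ⟩
    (k + k + k) + (k + k + k)             ≤⟨ +-mono-≤ h₁ h₂ ⟩
    (v + (i + i + x)) + (v + (i + i + y)) ≡⟨ e₂ v i x y ⟩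
    4 * i + 2 * v + (x + y)               ≤⟨ +-monoʳ-≤ (4 * i + 2 * v) h₃ ⟩
    4 * i + 2 * v + (k + i)               ≡⟨ e₃ k v i ⟩
    5 * i + 2 * v + k                     ∎)
    where
    e₁ : ∀ k → 5 * k + k ≡ (k + k + k) + (k + k + k)
    e₁ = solve-∀
    e₂ : ∀ v i x y → (v + (i + i + x)) + (v + (i + i + y)) ≡ 4 * i + 2 * v + (x + y)
    e₂ = solve-∀
    e₃ : ∀ k v i → 4 * i + 2 * v + (k + i) ≡ 5 * i + 2 * v + k
    e₃ = solve-∀

∣p++q∣≡∣p∣+∣q∣ : ∀ {a b} (p : Subset a) (q : Subset b) → ∣ p ++ q ∣ ≡ ∣ p ∣ + ∣ q ∣
∣p++q∣≡∣p∣+∣q∣ []            q = refl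
∣p++q∣≡∣p∣+∣q∣ (inside  ∷ p) q = cong suc (∣p++q∣≡∣p∣+∣q∣ p q)
∣p++q∣≡∣p∣+∣q∣ (outside ∷ p) q = ∣p++q∣≡∣p∣+∣q∣ p q

∣[p++q]∩[p′++q′]∣≡∣p∩p′∣+∣q∩q′∣ : ∀ {a b} (p p′ : Subset a) (q q′ : Subset b) →
  ∣ (p ++ q) ∩ (p′ ++ q′) ∣ ≡ ∣ p ∩ p′ ∣ + ∣ q ∩ q′ ∣
∣[p++q]∩[p′++q′]∣≡∣p∩p′∣+∣q∩q′∣ p p′ q q′ =
  trans (cong ∣_∣ (zipWith-++ _ p q p′ q′)) (∣p++q∣≡∣p∣+∣q∣ (p ∩ p′) (q ∩ q′))

blowUp : ∀ x → Subset v → Subset (v * x)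
blowUp x []      = []
blowUp x (s ∷ p) = replicate x s ++ blowUp x p

blowUp-∩ : ∀ x (p q : Subset v) → blowUp x p ∩ blowUp x q ≡ blowUp x (p ∩ q)
blowUp-∩ x []      []      = refl
blowUp-∩ x (s ∷ p) (t ∷ q) =
  trans (zipWith-++ _ (replicate x s) (blowUp x p) (replicate x t) (blowUp x q))
        (cong₂ _++_ (zipWith-replicate _ s t) (blowUp-∩ x p q))

∣blowUp-x-p∣≡∣p∣*x : ∀ x (p : Subset v) → ∣ blowUp x p ∣ ≡ ∣ p ∣ * x
∣blowUp-x-p∣≡∣p∣*x x []            = refl
∣blowUp-x-p∣≡∣p∣*x x (inside  ∷ p) = trans (∣p++q∣≡∣p∣+∣q∣ (replicate x inside) (blowUp x p))
                                 (cong₂ _+_ (∣⊤∣≡n x) (∣blowUp-x-p∣≡∣p∣*x x p))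
∣blowUp-x-p∣≡∣p∣*x x (outside ∷ p) = trans (∣p++q∣≡∣p∣+∣q∣ (replicate x outside) (blowUp x p))
                                 (cong₂ _+_ (∣⊥∣≡0 x) (∣blowUp-x-p∣≡∣p∣*x x p))

_⊕_ : ClosedWalk v k i m → ClosedWalk v′ k′ i′ m → ClosedWalk (v + v′) (k + k′) (i + i′) m
_⊕_ {i = i} {i′ = i′} W W′ = record
  { vert     = λ j → vert W j ++ vert W′ j
  ; vertSize = λ j → trans (∣p++q∣≡∣p∣+∣q∣ (vert W j) (vert W′ j))
                           (cong₂ _+_ (vertSize W j) (vertSize W′ j))
  ; step     = λ j → adj (inject₁ j) (suc j) (step W j) (step W′ j)
  ; close    = adj (fromℕ _) zero (close W) (close W′)
  }
  where
  adj : ∀ a b → ∣ vert W a ∩ vert W b ∣ ≡ i → ∣ vert W′ a ∩ vert W′ b ∣ ≡ i′ →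
        ∣ (vert W a ++ vert W′ a) ∩ (vert W b ++ vert W′ b) ∣ ≡ i + i′
  adj a b eq eq′ = trans (∣[p++q]∩[p′++q′]∣≡∣p∩p′∣+∣q∩q′∣ (vert W a) (vert W b) (vert W′ a) (vert W′ b))
                         (cong₂ _+_ eq eq′)

_⊕ᶜ_ : Cycle v k i m → ClosedWalk v′ k′ i′ m → Cycle (v + v′) (k + k′) (i + i′) m
C ⊕ᶜ W = toCycle (underlyingWalk C ⊕ W) (λ eq → Cycle.distinct C (++-injectiveˡ _ _ eq))

scale : ∀ x → ClosedWalk v k i m → ClosedWalk (v * x) (k * x) (i * x) m
scale {v = v} {i = i} x W = record
  { vert     = λ j → blowUp x (vert W j)
  ; vertSize = λ j → trans (∣blowUp-x-p∣≡∣p∣*x x (vert W j)) (cong (_* x) (vertSize W j))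
  ; step     = λ j → adj (vert W (inject₁ j)) (vert W (suc j)) (step W j)
  ; close    = adj (vert W (fromℕ _)) (vert W zero) (close W)
  }
  where
  adj : (p q : Subset v) → ∣ p ∩ q ∣ ≡ i → ∣ blowUp x p ∩ blowUp x q ∣ ≡ i * x
  adj p q eq = trans (cong ∣_∣ (blowUp-∩ x p q)) (trans (∣blowUp-x-p∣≡∣p∣*x x (p ∩ q)) (cong (_* x) eq))

constantWalk : (p : Subset v) → ∣ p ∣ ≡ k → ClosedWalk v k k m
constantWalk p ∣p∣≡k = record
  { vert = λ _ → p ; vertSize = λ _ → ∣p∣≡k ; step = λ _ → ∣p∩p∣≡k ; close = ∣p∩p∣≡k }
  where ∣p∩p∣≡k = trans (cong ∣_∣ (∩-idem p)) ∣p∣≡k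

fullWalk : ∀ t → ClosedWalk t t t m
fullWalk t = constantWalk ⊤ (∣⊤∣≡n t)

emptyWalk : ∀ r → ClosedWalk r 0 0 m
emptyWalk r = constantWalk ⊥ (∣⊥∣≡0 r)

castWalk : v ≡ v′ → k ≡ k′ → i ≡ i′ → ClosedWalk v k i m → ClosedWalk v′ k′ i′ m
castWalk refl refl refl W = W

castCycle : v ≡ v′ → k ≡ k′ → i ≡ i′ → Cycle v k i m → Cycle v′ k′ i′ m
castCycle refl refl refl C = C

decideWalk : (vs : Vec (Subset v) (suc m)) →
  {True (Fin.all? λ j → ∣ lookup vs j ∣ ℕ.≟ k)} →
  {True (Fin.all? λ j → ∣ lookup vs (inject₁ j) ∩ lookup vs (suc j) ∣ ℕ.≟ i)} →
  {True (∣ lookup vs (fromℕ m) ∩ lookup vs zero ∣ ℕ.≟ i)} →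
  ClosedWalk v k i m
decideWalk vs {sizes} {steps} {closing} = record
  { vert = lookup vs ; vertSize = toWitness sizes ; step = toWitness steps ; close = toWitness closing }

injective? : ∀ {n} (f : Fin n → Subset v) → Dec (∀ a b → f a ≡ f b → a ≡ b)
injective? f = Fin.all? λ a → Fin.all? λ b → ≡-dec _≟_ (f a) (f b) →-dec (a Fin.≟ b)

decideCycle : (W : ClosedWalk v k i m) → {True (injective? (vert W))} → Cycle v k i m
decideCycle W {inj} = toCycle W (λ {a} {b} → toWitness inj a b)

triangle₃₂₁ : ClosedWalk 3 2 1 2
triangle₃₂₁ = decideWalk (⁅ # 0 ⁆ ∪ ⁅ # 1 ⁆ ∷ ⁅ # 1 ⁆ ∪ ⁅ # 2 ⁆ ∷ ⁅ # 2 ⁆ ∪ ⁅ # 0 ⁆ ∷ [])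

triangle₃₁₀ : ClosedWalk 3 1 0 2
triangle₃₁₀ = decideWalk (⁅ # 0 ⁆ ∷ ⁅ # 1 ⁆ ∷ ⁅ # 2 ⁆ ∷ [])

square₄₁₀ : Cycle 4 1 0 3
square₄₁₀ = decideCycle (decideWalk (⁅ # 0 ⁆ ∷ ⁅ # 1 ⁆ ∷ ⁅ # 2 ⁆ ∷ ⁅ # 3 ⁆ ∷ []))

square₄₂₁ : Cycle 4 2 1 3
square₄₂₁ = decideCycle (decideWalk
  (⁅ # 0 ⁆ ∪ ⁅ # 1 ⁆ ∷ ⁅ # 1 ⁆ ∪ ⁅ # 2 ⁆ ∷ ⁅ # 2 ⁆ ∪ ⁅ # 3 ⁆ ∷ ⁅ # 3 ⁆ ∪ ⁅ # 0 ⁆ ∷ []))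

pentagon₅₂₀ : Cycle 5 2 0 4
pentagon₅₂₀ = decideCycle (decideWalk
  (⁅ # 0 ⁆ ∪ ⁅ # 1 ⁆ ∷ ⁅ # 2 ⁆ ∪ ⁅ # 3 ⁆ ∷ ⁅ # 4 ⁆ ∪ ⁅ # 0 ⁆ ∷ ⁅ # 1 ⁆ ∪ ⁅ # 2 ⁆ ∷ ⁅ # 3 ⁆ ∪ ⁅ # 4 ⁆ ∷ []))

hexagon₅₂₀ : Cycle 5 2 0 5
hexagon₅₂₀ = decideCycle (decideWalk
  (⁅ # 0 ⁆ ∪ ⁅ # 2 ⁆ ∷ ⁅ # 1 ⁆ ∪ ⁅ # 3 ⁆ ∷ ⁅ # 0 ⁆ ∪ ⁅ # 4 ⁆ ∷
   ⁅ # 1 ⁆ ∪ ⁅ # 2 ⁆ ∷ ⁅ # 0 ⁆ ∪ ⁅ # 3 ⁆ ∷ ⁅ # 1 ⁆ ∪ ⁅ # 4 ⁆ ∷ []))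

alternating₄ : ClosedWalk 2 1 0 3
alternating₄ = decideWalk (⁅ # 0 ⁆ ∷ ⁅ # 1 ⁆ ∷ ⁅ # 0 ⁆ ∷ ⁅ # 1 ⁆ ∷ [])

alternating₆ : ClosedWalk 2 1 0 5
alternating₆ = decideWalk (⁅ # 0 ⁆ ∷ ⁅ # 1 ⁆ ∷ ⁅ # 0 ⁆ ∷ ⁅ # 1 ⁆ ∷ ⁅ # 0 ⁆ ∷ ⁅ # 1 ⁆ ∷ [])

triangleWalk : ∀ x s t r → ClosedWalk (3 * x + 3 * s + t + r) (2 * x + s + t) (x + t) 2
triangleWalk x s t r = castWalk (e₁ x s t r) (e₂ x s t) (e₃ x s t)
  (scale x triangle₃₂₁ ⊕ (scale s triangle₃₁₀ ⊕ (fullWalk t ⊕ emptyWalk r)))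
  where
  e₁ : ∀ x s t r → 3 * x + (3 * s + (t + r)) ≡ 3 * x + 3 * s + t + r
  e₁ = solve-∀
  e₂ : ∀ x s t → 2 * x + (1 * s + (t + 0)) ≡ 2 * x + s + t
  e₂ = solve-∀
  e₃ : ∀ x s t → 1 * x + (0 * s + (t + 0)) ≡ x + t
  e₃ = solve-∀

-- With d = k − i: if i ≤ d, three blocks of i points shared by pairs plus d − i private points
-- per vertex; otherwise three blocks of d points shared by pairs plus i − d points common to all.
triangle-exists : i < k → 2 * k ≤ v → 3 * (k ∸ i) ≤ v → Cycle v k i 2
triangle-exists {i = i} {v = v} i<k 2k≤v 3d≤v with m≤n⇒∃[o]m+o≡n (<⇒≤ i<k)
... | d , refl with ≤-total i d
... | inj₁ i≤d with m≤n⇒∃[o]m+o≡n i≤d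
...   | s , refl with m≤n⇒∃[o]m+o≡n (subst (λ e → 3 * e ≤ v) (m+n∸m≡n i (i + s)) 3d≤v)
...     | r , refl = closedWalk₃⇒cycle i<k (castWalk (e₁ i s r) (e₂ i s) (+-identityʳ i) (triangleWalk i s 0 r))
  where
  e₁ : ∀ i s r → 3 * i + 3 * s + 0 + r ≡ 3 * (i + s) + r
  e₁ = solve-∀
  e₂ : ∀ i s → 2 * i + s + 0 ≡ i + (i + s)
  e₂ = solve-∀
triangle-exists {v = v} i<k 2k≤v 3d≤v | d , refl | inj₂ d≤i with m≤n⇒∃[o]m+o≡n d≤i
...   | t , refl with m≤n⇒∃[o]m+o≡n 2k≤v
...     | r , refl = closedWalk₃⇒cycle i<k (castWalk (e₁ d t r) (e₂ d t) refl (triangleWalk d 0 t (d + t + r)))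
  where
  e₁ : ∀ d t r → 3 * d + 3 * 0 + t + (d + t + r) ≡ 2 * (d + t + d) + r
  e₁ = solve-∀
  e₂ : ∀ d t → 2 * d + 0 + t ≡ d + t + d
  e₂ = solve-∀

square-disjoint : 0 < k → 2 * k + 2 ≤ v → Cycle v k 0 3
square-disjoint {k = suc u} _ 2k+2≤v with m≤n⇒∃[o]m+o≡n 2k+2≤v
... | r , refl = castCycle (e₁ u r) (e₂ u) (e₃ u) (square₄₁₀ ⊕ᶜ (scale u alternating₄ ⊕ emptyWalk r))
  where
  e₁ : ∀ u r → 4 + (2 * u + r) ≡ 2 * (1 + u) + 2 + r
  e₁ = solve-∀
  e₂ : ∀ u → 1 + (1 * u + 0) ≡ 1 + u
  e₂ = solve-∀
  e₃ : ∀ u → 0 + (0 * u + 0) ≡ 0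
  e₃ = solve-∀

square-overlapping : 0 < i → i < k → 2 * k ≤ v → Cycle v k i 3
square-overlapping {i = suc m} _ i<k 2k≤v with m≤n⇒∃[o]m+o≡n i<k
... | u , refl with m≤n⇒∃[o]m+o≡n 2k≤v
... | r , refl = castCycle (e₁ m u r) (e₂ m u) (e₃ m u)
  (square₄₂₁ ⊕ᶜ (scale u alternating₄ ⊕ (fullWalk m ⊕ emptyWalk (m + r))))
  where
  e₁ : ∀ m u r → 4 + (2 * u + (m + (m + r))) ≡ 2 * (2 + m + u) + r
  e₁ = solve-∀
  e₂ : ∀ m u → 2 + (1 * u + (m + 0)) ≡ 2 + m + u
  e₂ = solve-∀
  e₃ : ∀ m u → 1 + (0 * u + (m + 0)) ≡ 1 + m
  e₃ = solve-∀

square-exists : i < k → 2 * k ≤ v → ¬ (v ≡ 2 * k × i ≡ 0) → ¬ (v ≡ 2 * k + 1 × i ≡ 0) → Cycle v k i 3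
square-exists {i = suc _} i<k 2k≤v _ _ = square-overlapping (s≤s z≤n) i<k 2k≤v
square-exists {i = zero} {k} 0<k 2k≤v v≢2k v≢2k+1 with m≤n⇒∃[o]m+o≡n 2k≤v
... | zero        , refl = ⊥-elim (v≢2k (+-identityʳ (2 * k) , refl))
... | suc zero    , refl = ⊥-elim (v≢2k+1 (refl , refl))
... | suc (suc r) , refl = square-disjoint 0<k (+-monoʳ-≤ (2 * k) (s≤s (s≤s z≤n)))

hexagon-exists : 2 ≤ k → Cycle (2 * k + 1) k 0 5
hexagon-exists 2≤k with m≤n⇒∃[o]m+o≡n 2≤k
... | u , refl = castCycle (e₁ u) (e₂ u) (e₃ u) (hexagon₅₂₀ ⊕ᶜ scale u alternating₆)
  where
  e₁ : ∀ u → 5 + 2 * u ≡ 2 * (2 + u) + 1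
  e₁ = solve-∀
  e₂ : ∀ u → 2 + 1 * u ≡ 2 + u
  e₂ = solve-∀
  e₃ : ∀ u → 0 + 0 * u ≡ 0
  e₃ = solve-∀

NoCycleBelow : (v k i g : ℕ) → Set
NoCycleBelow v k i g = ∀ n → n < g → ¬ HasCycle v k i n

noCycleBelow3 : NoCycleBelow v k i 3
noCycleBelow3 zero                _                        ()
noCycleBelow3 (suc zero)          _                        (s≤s () , _)
noCycleBelow3 (suc (suc zero))    _                        (s≤s (s≤s ()) , _)
noCycleBelow3 (suc (suc (suc _))) (s≤s (s≤s (s≤s ()))) _

noCycleBelow-suc : ∀ {g} → NoCycleBelow v k i g → ¬ HasCycle v k i g → NoCycleBelow v k i (suc g)
noCycleBelow-suc below none n n<1+g with m<1+n⇒m<n∨m≡n n<1+g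
... | inj₁ n<g  = below n n<g
... | inj₂ refl = none

hasCycle : Cycle v k i (suc (suc m)) → HasCycle v k i (3 + m)
hasCycle c = s≤s (s≤s (s≤s z≤n)) , c

noTriangle : v < 3 * (k ∸ i) → ¬ HasCycle v k i 3
noTriangle {v} {k} {i} v<3d (_ , c) = <⇒≱ v<3d (begin
  3 * (k ∸ i)    ≡⟨ *-distribˡ-∸ 3 k i ⟩
  3 * k ∸ 3 * i  ≤⟨ m≤n+o⇒m∸n≤o (3 * k) (3 * i) (triangle-bound (underlyingWalk c)) ⟩
  v              ∎)
  where open ≤-Reasoning

noSquare-oddGraph : ¬ HasCycle (2 * k + 1) k 0 4
noSquare-oddGraph {k} (_ , c) with +-cancelˡ-≤ (2 * k) 2 1 (square-bound c)
... | s≤s ()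

noPentagon-oddGraph : 2 < k → ¬ HasCycle (2 * k + 1) k 0 5
noPentagon-oddGraph {k} 2<k (_ , c) = <⇒≱ 2<k (+-cancelˡ-≤ (4 * k) k 2 (begin
  4 * k + k            ≡⟨ e₁ k ⟩
  5 * k                ≤⟨ pentagon-bound (underlyingWalk c) ⟩
  2 * (2 * k + 1)      ≡⟨ e₂ k ⟩
  4 * k + 2            ∎))
  where
  open ≤-Reasoning
  e₁ : ∀ k → 4 * k + k ≡ 5 * k
  e₁ = solve-∀
  e₂ : ∀ k → 2 * (2 * k + 1) ≡ 4 * k + 2
  e₂ = solve-∀

girth-triangle : i < k → 2 * k ≤ v → 3 * (k ∸ i) ≤ v → GirthIs v k i 3
girth-triangle i<k 2k≤v 3d≤v = hasCycle (triangle-exists i<k 2k≤v 3d≤v) , noCycleBelow3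

girth-square : i < k → 2 * k ≤ v → ¬ (v ≡ 2 * k × i ≡ 0) →
               v < 3 * (k ∸ i) → ¬ (v ≡ 2 * k + 1 × i ≡ 0) → GirthIs v k i 4
girth-square i<k 2k≤v v≢2k v<3d v≢2k+1 =
  hasCycle (square-exists i<k 2k≤v v≢2k v≢2k+1) , noCycleBelow-suc noCycleBelow3 (noTriangle v<3d)

girth-petersen : v ≡ 5 → k ≡ 2 → i ≡ 0 → GirthIs v k i 5
girth-petersen refl refl refl =
  hasCycle pentagon₅₂₀ , noCycleBelow-suc (noCycleBelow-suc noCycleBelow3 (noTriangle ≤-refl)) noSquare-oddGraph

girth-oddGraph : v ≡ 2 * k + 1 → i ≡ 0 → 2 < k → GirthIs v k i 6
girth-oddGraph {k = k} refl refl 2<k =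
    hasCycle (hexagon-exists (<⇒≤ 2<k))
  , noCycleBelow-suc (noCycleBelow-suc (noCycleBelow-suc noCycleBelow3 (noTriangle 2k+1<3k)) noSquare-oddGraph)
                     (noPentagon-oddGraph 2<k)
  where
  2k+1<3k : 2 * k + 1 < 3 * k
  2k+1<3k = begin-strict
    2 * k + 1  <⟨ +-monoʳ-< (2 * k) (<⇒≤ 2<k) ⟩
    2 * k + k  ≡⟨ e k ⟩
    3 * k      ∎
    where
    open ≤-Reasoning
    e : ∀ k → 2 * k + k ≡ 3 * k
    e = solve-∀

theorem2p4 : (v k i : ℕ) → i < k → k < v → 2 * k ≤ v → ¬ (v ≡ 2 * k × i ≡ 0) →
    (3 * (k ∸ i) ≤ v → GirthIs v k i 3)
    × (v < 3 * (k ∸ i) → ¬ (v ≡ 2 * k + 1 × i ≡ 0) → GirthIs v k i 4)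
    × (v ≡ 5 → k ≡ 2 → i ≡ 0 → GirthIs v k i 5)
    × (v ≡ 2 * k + 1 → i ≡ 0 → 2 < k → GirthIs v k i 6)
-- The hypothesis k < v follows from i < k and 2k ≤ v.
theorem2p4 v k i i<k _ 2k≤v v≢2k =
    girth-triangle i<k 2k≤v
  , girth-square i<k 2k≤v v≢2k
  , girth-petersen
  , girth-oddGraph
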